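{- Let $t\in\mathbb{N}$, let $G$ be a graph and let $X,Y\subseteq V(G)$ be such that $|X|\leq t$, $|X\cup Y|\geq t$, and $\delta(G[X])\geq \frac t2$ and $\delta(G[Y])\geq \frac t2$. Write $x=\frac{|X|}{t}$ and $y=\frac{|Y|}{t}$. Then $G$ has a subgraph on $t$ vertices with at least $\left(\frac12\left(x+\frac{(1-x)^2}{y}\right)-\frac1t\right)\binom{t}{2}$ edges.
   Context: All graphs are finite and simple. $G[X]$ denotes the subgraph of $G$ induced by $X$, and $\delta(H)$ denotes the minimum degree of a graph $H$. -}

module Defs where

open import Data.Nat using (ℕ; zero; suc; _+_; _*_; _≤_)
open import Data.Bool using (Bool; true; false; if_then_else_; _∧_)
open import Data.Fin using (Fin; toℕ; _<?_)
open import Data.Fin.Subset using (Subset)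
open import Data.List using (List; map; allFin)
open import Data.Nat.ListAction using (sum)
open import Data.Vec using (lookup)
open import Data.Integer using (+_)
open import Data.Rational using (ℚ; 0ℚ; _÷_; ≢-nonZero)
open import Data.Rational.Properties using (_≟_)
open import Data.Product using (_×_)
open import Relation.Nullary using (yes; no)
open import Relation.Nullary.Decidable using (⌊_⌋)
open import Relation.Binary.PropositionalEquality using (_≡_)

record Graph (n : ℕ) : Set where
  field
    adj   : Fin n → Fin n → Bool
    sym   : ∀ i j → adj i j ≡ adj j i
    irrefl : ∀ i → adj i i ≡ false
open Graph public

degIn : ∀ {n} → Graph n → Subset n → Fin n → ℕ
degIn G X v = sum (map (λ u → if lookup X u ∧ adj G v u then 1 else 0) (allFin _))

record Subgraph {n : ℕ} (G : Graph n) : Set where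
  field
    vert   : Subset n
    edge   : Fin n → Fin n → Bool
    e-sym  : ∀ i j → edge i j ≡ edge j i
    e-adj  : ∀ i j → edge i j ≡ true → adj G i j ≡ true
    e-vert : ∀ i j → edge i j ≡ true → (lookup vert i ≡ true) × (lookup vert j ≡ true)
open Subgraph public

edgeCount : ∀ {n} {G : Graph n} → Subgraph G → ℕ
edgeCount {n} H =
  sum (map (λ i → sum (map (λ j → if ⌊ i <? j ⌋ ∧ edge H i j then 1 else 0) (allFin n))) (allFin n))

vcount : ∀ {n} {G : Graph n} → Subgraph G → ℕ
vcount H = Data.Fin.Subset.∣ vert H ∣

-- Rational division with the convention p / 0 = 0 (only used when the
-- numerator is forced to be 0).
_÷₀_ : ℚ → ℚ → ℚ
p ÷₀ q with q ≟ 0ℚ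
... | yes _ = 0ℚ
... | no q≢0 = _÷_ p q {{≢-nonZero q≢0}}

{-# OPTIONS --safe #-}

-- Let a = |X|, k = t − a and Y′ = Y ∖ X, so that k ≤ |Y′|. For Z ⊆ Y′ put
-- gain Z = 2 e(X, Z) + 2 e(Z), twice the number of edges Z adds to G[X]. The marginal gains of
-- the vertices of Z sum to at most 2 gain Z, so deleting a vertex of least marginal gain keeps a
-- fraction (|Z| − 2)/|Z| of the gain; deleting greedily from Y′ down to a k-set T therefore gives
-- gain T ≥ gain Y′ · k(k − 1) / (|Y′|(|Y′| − 1)). The degree conditions give 2 e(X) ≥ ta/2 and
-- gain Y′ ≥ t|Y′|/2, so S = X ∪ T has t vertices and 4 e(S) ≥ ta + tk(k − 1)/(|Y′| − 1), which
-- after clearing the denominators 4|Y| and t is the claimed bound.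
module Submission where

open import Defs renaming (sym to adj-sym)
open import Data.Nat using (ℕ; zero; suc; _+_; _*_; _∸_; _≤_; _<_; z≤n; s≤s; z<s; NonZero; ≢-nonZero⁻¹; _≤?_)
open import Data.Nat.Properties hiding (_≟_; _<?_; <-cmp)
open import Data.Nat.ListAction using () renaming (sum to sumᴸ)
open import Data.Nat.Combinatorics using (_C_; nCk+nC[k+1]≡[n+1]C[k+1]; nC1≡n)
open import Data.Nat.Tactic.RingSolver using (solve-∀)
open import Data.Bool using (Bool; true; false; _∧_; _∨_; not; if_then_else_)
import Data.Bool.Properties as Bool
open import Data.Fin using (Fin; zero; suc; _≟_; _<?_)
open import Data.Fin.Properties using (any?; <-cmp) renaming (<-asym to <-asymᶠ)
open import Data.Fin.Subset using (Subset; ∣_∣; _∪_; _∈_)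
open import Data.Vec using ([]; _∷_; lookup; tabulate)
open import Data.Vec.Properties using (lookup∘tabulate; lookup-zipWith; lookup⇒[]=)
open import Data.List using (map; allFin) renaming (tabulate to tabulateᴸ)
open import Data.List.Properties using (map-tabulate)
open import Data.Integer using (+_)
import Data.Integer as ℤ
import Data.Integer.Properties as ℤ
open import Data.Rational using (ℚ; _/_; ½; 1ℚ; 0ℚ; toℚᵘ; 1/_; _÷_; ≢-nonZero; Positive; NonNegative)
  renaming (_+_ to _+ℚ_; _-_ to _-ℚ_; _*_ to _*ℚ_; _≤_ to _≤ℚ_)
import Data.Rational as ℚ
import Data.Rational.Properties as ℚ
open import Data.Rational.Unnormalised using (mkℚᵘ; *≡*; *≤*) renaming (_≃_ to _≃ᵘ_)
import Data.Rational.Unnormalised as ℚᵘ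
import Data.Rational.Unnormalised.Properties as ℚᵘ
open import Data.Rational.Solver using (module +-*-Solver)
open import Data.Product using (Σ; _×_; _,_; proj₁; proj₂)
open import Relation.Nullary using (does; yes; no; contradiction)
open import Relation.Nullary.Decidable using (⌊_⌋; _×-dec_)
open import Relation.Binary.Definitions using (tri<; tri≈; tri>)
open import Relation.Binary.PropositionalEquality
open import Algebra.Properties.CommutativeSemigroup *-commutativeSemigroup using (x∙yz≈y∙xz)
open import Algebra.Properties.Semiring.Sum +-*-semiring
  using (sum-syntax; ∑-distrib-+; ∑-comm; *-distribˡ-sum; *-distribʳ-sum; sum-cong-≗; sum-replicate-zero)

∑-mono-≤ : ∀ {n} {f g : Fin n → ℕ} → (∀ i → f i ≤ g i) → ∑[ i < n ] f i ≤ ∑[ i < n ] g i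
∑-mono-≤ {zero}  f≤g = z≤n
∑-mono-≤ {suc n} f≤g = +-mono-≤ (f≤g zero) (∑-mono-≤ (λ i → f≤g (suc i)))

sumᴸ-allFin : ∀ {n} (f : Fin n → ℕ) → sumᴸ (map f (allFin n)) ≡ ∑[ i < n ] f i
sumᴸ-allFin {n} f = trans (cong sumᴸ (map-tabulate (λ i → i) f)) (sum-tabulate f)
  where
  sum-tabulate : ∀ {m} (g : Fin m → ℕ) → sumᴸ (tabulateᴸ g) ≡ ∑[ i < m ] g i
  sum-tabulate {zero}  g = refl
  sum-tabulate {suc m} g = cong (_+_ (g zero)) (sum-tabulate (λ i → g (suc i)))

𝟙 : Bool → ℕ
𝟙 b = if b then 1 else 0

∧-true⁻ : ∀ {a b} → a ∧ b ≡ true → a ≡ true × b ≡ true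
∧-true⁻ {true} {true} refl = refl , refl

𝟙-∧ : ∀ a b → 𝟙 (a ∧ b) ≡ 𝟙 a * 𝟙 b
𝟙-∧ true  b = sym (+-identityʳ _)
𝟙-∧ false b = refl

𝟙-∨ : ∀ p q → 𝟙 (p ∨ q) ≡ 𝟙 p + 𝟙 (q ∧ not p)
𝟙-∨ true  true  = refl
𝟙-∨ true  false = refl
𝟙-∨ false true  = refl
𝟙-∨ false false = refl

𝟙-∨-disjoint : ∀ p q → (q ≡ true → p ≡ false) → 𝟙 (p ∨ q) ≡ 𝟙 p + 𝟙 q
𝟙-∨-disjoint true  true  q⇒¬p with () ← q⇒¬p refl
𝟙-∨-disjoint true  false _    = refl
𝟙-∨-disjoint false q     _    = refl

𝟙-∧-not-≤ : ∀ p q → 𝟙 (q ∧ not p) ≤ 𝟙 q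
𝟙-∧-not-≤ true  true  = z≤n
𝟙-∧-not-≤ false true  = ≤-refl
𝟙-∧-not-≤ p     false = z≤n

𝟙-≤-𝟙+𝟙-∧-not : ∀ p q → 𝟙 q ≤ 𝟙 p + 𝟙 (q ∧ not p)
𝟙-≤-𝟙+𝟙-∧-not true  true  = ≤-refl
𝟙-≤-𝟙+𝟙-∧-not true  false = z≤n
𝟙-≤-𝟙+𝟙-∧-not false true  = ≤-refl
𝟙-≤-𝟙+𝟙-∧-not false false = z≤n

δ : ∀ {n} → Fin n → Fin n → ℕ
δ v u = 𝟙 (does (v ≟ u))

∑-δ : ∀ {n} (v : Fin n) (f : Fin n → ℕ) → ∑[ u < n ] (δ v u * f u) ≡ f v
∑-δ {suc n} zero    f = trans (cong (_+_ (f zero + 0)) (sum-replicate-zero n)) (trans (+-identityʳ _) (+-identityʳ _))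
∑-δ {suc n} (suc v) f = ∑-δ v (λ u → f (suc u))

χ : ∀ {n} → (Fin n → Bool) → Fin n → ℕ
χ S i = 𝟙 (S i)

count : ∀ {n} → (Fin n → Bool) → ℕ
count {n} S = ∑[ i < n ] χ S i

∣∣≡count : ∀ {n} (V : Subset n) → ∣ V ∣ ≡ count (lookup V)
∣∣≡count []          = refl
∣∣≡count (true ∷ V)  = cong suc (∣∣≡count V)
∣∣≡count (false ∷ V) = ∣∣≡count V

_∖_ : ∀ {n} → (Fin n → Bool) → (Fin n → Bool) → Fin n → Bool
(Y ∖ X) u = Y u ∧ not (X u)

_─_ : ∀ {n} → (Fin n → Bool) → Fin n → Fin n → Bool
Z ─ v = Z ∖ λ u → does (v ≟ u)

∣∪∣≡∣∣+count∖ : ∀ {n} (X Y : Subset n) → ∣ X ∪ Y ∣ ≡ ∣ X ∣ + count (lookup Y ∖ lookup X)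
∣∪∣≡∣∣+count∖ {n} X Y = begin
  ∣ X ∪ Y ∣                                                  ≡⟨ ∣∣≡count (X ∪ Y) ⟩
  count (lookup (X ∪ Y))                                     ≡⟨ sum-cong-≗ {n} (λ u → trans (cong 𝟙 (lookup-zipWith _∨_ u X Y)) (𝟙-∨ (lookup X u) (lookup Y u))) ⟩
  ∑[ u < n ] (χ (lookup X) u + χ (lookup Y ∖ lookup X) u)    ≡⟨ ∑-distrib-+ {n} _ _ ⟩
  count (lookup X) + count (lookup Y ∖ lookup X)             ≡⟨ cong (_+ count (lookup Y ∖ lookup X)) (∣∣≡count X) ⟨
  ∣ X ∣ + count (lookup Y ∖ lookup X)                        ∎
  where open ≡-Reasoning

t∸∣X∣≤count∖ : ∀ {n} (X Y : Subset n) {t} → t ≤ ∣ X ∪ Y ∣ → t ∸ ∣ X ∣ ≤ count (lookup Y ∖ lookup X)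
t∸∣X∣≤count∖ X Y {t} t≤∣X∪Y∣ = m≤n+o⇒m∸n≤o t ∣ X ∣ (subst (t ≤_) (∣∪∣≡∣∣+count∖ X Y) t≤∣X∪Y∣)

count∖≤∣∣ : ∀ {n} (X Y : Subset n) → count (lookup Y ∖ lookup X) ≤ ∣ Y ∣
count∖≤∣∣ X Y = subst (count (lookup Y ∖ lookup X) ≤_) (sym (∣∣≡count Y)) (∑-mono-≤ (λ u → 𝟙-∧-not-≤ (lookup X u) (lookup Y u)))

χ-─ : ∀ {n} (Z : Fin n → Bool) {v} → Z v ≡ true → ∀ u → χ Z u ≡ χ (Z ─ v) u + δ v u
χ-─ Z {v} Zv u with v ≟ u
... | yes refl rewrite Zv = refl
... | no  _    rewrite Bool.∧-identityʳ (Z u) = sym (+-identityʳ _)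

count-─ : ∀ {n} (Z : Fin n → Bool) {v} → Z v ≡ true → count Z ≡ suc (count (Z ─ v))
count-─ {n} Z {v} Zv = begin
  count Z                                             ≡⟨ sum-cong-≗ {n} (χ-─ Z Zv) ⟩
  ∑[ u < n ] (χ (Z ─ v) u + δ v u)                    ≡⟨ ∑-distrib-+ {n} (χ (Z ─ v)) (δ v) ⟩
  count (Z ─ v) + ∑[ u < n ] δ v u                    ≡⟨ cong (_+_ (count (Z ─ v))) (sum-cong-≗ {n} (λ u → sym (*-identityʳ (δ v u)))) ⟩
  count (Z ─ v) + ∑[ u < n ] (δ v u * 1)              ≡⟨ cong (_+_ (count (Z ─ v))) (∑-δ v (λ _ → 1)) ⟩
  count (Z ─ v) + 1                                   ≡⟨ +-comm (count (Z ─ v)) 1 ⟩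
  suc (count (Z ─ v))                                 ∎
  where open ≡-Reasoning

average-witness : ∀ {n} (Z : Fin n → Bool) (c : Fin n → ℕ) → 0 < count Z →
  Σ (Fin n) λ v → Z v ≡ true × count Z * c v ≤ ∑[ u < n ] (χ Z u * c u)
average-witness {n} Z c 0<s
  with any? (λ v → (Z v Bool.≟ true) ×-dec (count Z * c v ≤? ∑[ u < n ] (χ Z u * c u)))
... | yes (v , Zv , below) = v , Zv , below
... | no ∄v = contradiction (begin-strict
      s * S       <⟨ m<n+m (s * S) 0<s ⟩
      s + s * S   ≡⟨ sym (*-suc s S) ⟩
      s * suc S   ≡⟨ *-distribʳ-sum {n} (suc S) (χ Z) ⟩
      ∑[ u < n ] (χ Z u * suc S)     ≤⟨ ∑-mono-≤ above ⟩
      ∑[ u < n ] (s * (χ Z u * c u)) ≡⟨ sym (*-distribˡ-sum {n} s (λ u → χ Z u * c u)) ⟩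
      s * S       ∎) (<-irrefl refl)
  where
  open ≤-Reasoning
  s = count Z
  S = ∑[ u < n ] (χ Z u * c u)
  above : ∀ u → χ Z u * suc S ≤ s * (χ Z u * c u)
  above u with Z u in Zu
  ... | false = z≤n
  ... | true rewrite +-identityʳ (suc S) | +-identityʳ (c u) = ≰⇒> (λ below → ∄v (u , Zu , below))

split-by-order : ∀ {n} (f : Fin n → Fin n → ℕ) → (∀ i → f i i ≡ 0) → ∀ i j →
  f i j ≡ 𝟙 ⌊ i <? j ⌋ * f i j + 𝟙 ⌊ j <? i ⌋ * f i j
split-by-order f diag i j with i <? j | j <? i
... | yes i<j | yes j<i = contradiction j<i (<-asymᶠ i<j)
... | yes _   | no _    = sym (trans (+-identityʳ _) (+-identityʳ _))
... | no _    | yes _   = sym (+-identityʳ _)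
... | no i≮j  | no j≮i  with <-cmp i j
...   | tri< i<j _ _  = contradiction i<j i≮j
...   | tri> _ _ j<i  = contradiction j<i j≮i
...   | tri≈ _ refl _ = diag i

∑∑-symmetric : ∀ {n} (f : Fin n → Fin n → ℕ) → (∀ i j → f i j ≡ f j i) → (∀ i → f i i ≡ 0) →
  ∑[ i < n ] ∑[ j < n ] f i j ≡ 2 * ∑[ i < n ] ∑[ j < n ] (𝟙 ⌊ i <? j ⌋ * f i j)
∑∑-symmetric {n} f f-sym diag = begin
  ∑[ i < n ] ∑[ j < n ] f i j
    ≡⟨ sum-cong-≗ {n} (λ i → trans (sum-cong-≗ {n} (split-by-order f diag i)) (∑-distrib-+ {n} _ _)) ⟩
  ∑[ i < n ] (upper i + ∑[ j < n ] (𝟙 ⌊ j <? i ⌋ * f i j))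
    ≡⟨ ∑-distrib-+ {n} upper _ ⟩
  ∑[ i < n ] upper i + ∑[ i < n ] ∑[ j < n ] (𝟙 ⌊ j <? i ⌋ * f i j)
    ≡⟨ cong (_+_ (∑[ i < n ] upper i)) (∑-comm {n} {n} (λ i j → 𝟙 ⌊ j <? i ⌋ * f i j)) ⟩
  ∑[ i < n ] upper i + ∑[ j < n ] ∑[ i < n ] (𝟙 ⌊ j <? i ⌋ * f i j)
    ≡⟨ cong (_+_ (∑[ i < n ] upper i)) (sum-cong-≗ {n} (λ j → sum-cong-≗ {n} (λ i → cong (𝟙 ⌊ j <? i ⌋ *_) (f-sym i j)))) ⟩
  ∑[ i < n ] upper i + ∑[ j < n ] upper j
    ≡⟨ cong (_+_ (∑[ i < n ] upper i)) (sym (+-identityʳ _)) ⟩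
  2 * ∑[ i < n ] upper i ∎
  where
  open ≡-Reasoning
  upper : Fin n → ℕ
  upper i = ∑[ j < n ] (𝟙 ⌊ i <? j ⌋ * f i j)

module _ {n : ℕ} (G : Graph n) where

  private
    A : Fin n → Fin n → ℕ
    A v u = 𝟙 (adj G v u)

  deg : (Fin n → ℕ) → Fin n → ℕ
  deg q v = ∑[ u < n ] (q u * A v u)

  pairs : (Fin n → ℕ) → (Fin n → ℕ) → ℕ
  pairs p q = ∑[ v < n ] (p v * deg q v)

  degIn≡deg : ∀ X v → degIn G X v ≡ deg (χ (lookup X)) v
  degIn≡deg X v = trans (sumᴸ-allFin {n} _) (sum-cong-≗ {n} (λ u → 𝟙-∧ (lookup X u) (adj G v u)))

  min-degree-lookup : ∀ X {t} → (∀ v → v ∈ X → t ≤ 2 * degIn G X v) →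
    ∀ v → lookup X v ≡ true → t ≤ 2 * deg (χ (lookup X)) v
  min-degree-lookup X {t} δ[X] v Xv = subst (λ d → t ≤ 2 * d) (degIn≡deg X v) (δ[X] v (lookup⇒[]= v X Xv))

  deg-δ : ∀ v u → deg (δ v) u ≡ A u v
  deg-δ v u = ∑-δ v (A u)

  deg-+ : ∀ {q} q₁ q₂ → (∀ u → q u ≡ q₁ u + q₂ u) → ∀ v → deg q v ≡ deg q₁ v + deg q₂ v
  deg-+ q₁ q₂ q≡ v = trans
    (sum-cong-≗ {n} (λ u → trans (cong (_* A v u) (q≡ u)) (*-distribʳ-+ (A v u) (q₁ u) (q₂ u))))
    (∑-distrib-+ {n} _ _)

  deg-mono-≤ : ∀ {q q′} → (∀ u → q u ≤ q′ u) → ∀ v → deg q v ≤ deg q′ v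
  deg-mono-≤ q≤ v = ∑-mono-≤ (λ u → *-monoˡ-≤ (A v u) (q≤ u))

  pairs-+ˡ : ∀ {p} p₁ p₂ q → (∀ u → p u ≡ p₁ u + p₂ u) → pairs p q ≡ pairs p₁ q + pairs p₂ q
  pairs-+ˡ p₁ p₂ q p≡ = trans
    (sum-cong-≗ {n} (λ v → trans (cong (_* deg q v) (p≡ v)) (*-distribʳ-+ (deg q v) (p₁ v) (p₂ v))))
    (∑-distrib-+ {n} _ _)

  pairs-+ʳ : ∀ p {q} q₁ q₂ → (∀ u → q u ≡ q₁ u + q₂ u) → pairs p q ≡ pairs p q₁ + pairs p q₂
  pairs-+ʳ p q₁ q₂ q≡ = trans
    (sum-cong-≗ {n} (λ v → trans (cong (p v *_) (deg-+ q₁ q₂ q≡ v)) (*-distribˡ-+ (p v) (deg q₁ v) (deg q₂ v))))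
    (∑-distrib-+ {n} _ _)

  pairs-monoʳ-≤ : ∀ p {q q′} → (∀ u → q u ≤ q′ u) → pairs p q ≤ pairs p q′
  pairs-monoʳ-≤ p q≤ = ∑-mono-≤ (λ v → *-monoʳ-≤ (p v) (deg-mono-≤ q≤ v))

  pairs-δˡ : ∀ v q → pairs (δ v) q ≡ deg q v
  pairs-δˡ v q = ∑-δ v (deg q)

  pairs-comm : ∀ p q → pairs p q ≡ pairs q p
  pairs-comm p q = begin
    ∑[ v < n ] (p v * ∑[ u < n ] (q u * A v u))   ≡⟨ sum-cong-≗ {n} (λ v → *-distribˡ-sum {n} (p v) _) ⟩
    ∑[ v < n ] ∑[ u < n ] (p v * (q u * A v u))   ≡⟨ ∑-comm {n} {n} _ ⟩
    ∑[ u < n ] ∑[ v < n ] (p v * (q u * A v u))   ≡⟨ sum-cong-≗ {n} (λ u → sum-cong-≗ {n} (λ v → swap u v)) ⟩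
    ∑[ u < n ] ∑[ v < n ] (q u * (p v * A u v))   ≡⟨ sum-cong-≗ {n} (λ u → sym (*-distribˡ-sum {n} (q u) _)) ⟩
    ∑[ u < n ] (q u * ∑[ v < n ] (p v * A u v))   ∎
    where
    open ≡-Reasoning
    swap : ∀ u v → p v * (q u * A v u) ≡ q u * (p v * A u v)
    swap u v rewrite adj-sym G v u = x∙yz≈y∙xz (p v) (q u) (A u v)

  min-degree-pairs : ∀ t (P : Fin n → Bool) q → (∀ v → P v ≡ true → t ≤ 2 * deg q v) →
    t * count P ≤ 2 * pairs (χ P) q
  min-degree-pairs t P q t≤ = begin
    t * count P                         ≡⟨ *-distribˡ-sum {n} t (χ P) ⟩
    ∑[ v < n ] (t * χ P v)              ≤⟨ ∑-mono-≤ bound ⟩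
    ∑[ v < n ] (2 * (χ P v * deg q v))  ≡⟨ sym (*-distribˡ-sum {n} 2 _) ⟩
    2 * pairs (χ P) q                   ∎
    where
    open ≤-Reasoning
    bound : ∀ v → t * χ P v ≤ 2 * (χ P v * deg q v)
    bound v with P v in Pv
    ... | false = ≤-reflexive (*-zeroʳ t)
    ... | true rewrite *-identityʳ t | +-identityʳ (deg q v) = t≤ v Pv

  induced : (Fin n → Bool) → Subgraph G
  induced S = record
    { vert   = tabulate S
    ; edge   = λ i j → (S i ∧ S j) ∧ adj G i j
    ; e-sym  = λ i j → cong₂ _∧_ (Bool.∧-comm (S i) (S j)) (adj-sym G i j)
    ; e-adj  = λ i j e → proj₂ (∧-true⁻ e)
    ; e-vert = λ i j e → let Si , Sj = ∧-true⁻ (proj₁ (∧-true⁻ e))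
                         in trans (lookup∘tabulate S i) Si , trans (lookup∘tabulate S j) Sj
    }

  vcount-induced : ∀ S → vcount (induced S) ≡ count S
  vcount-induced S = trans (∣∣≡count (tabulate S)) (sum-cong-≗ {n} (λ i → cong 𝟙 (lookup∘tabulate S i)))

  edgeCount-induced : ∀ S → 2 * edgeCount (induced S) ≡ pairs (χ S) (χ S)
  edgeCount-induced S = begin
    2 * edgeCount (induced S)
      ≡⟨ cong (2 *_) (trans (sumᴸ-allFin {n} _) (sum-cong-≗ {n} (λ i → trans (sumᴸ-allFin {n} _) (sum-cong-≗ {n} (edge-𝟙 i))))) ⟩
    2 * ∑[ i < n ] ∑[ j < n ] (𝟙 ⌊ i <? j ⌋ * f i j)
      ≡⟨ sym (∑∑-symmetric f f-sym f-diag) ⟩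
    ∑[ i < n ] ∑[ j < n ] f i j
      ≡⟨ sum-cong-≗ {n} (λ i → sym (*-distribˡ-sum {n} (χ S i) _)) ⟩
    pairs (χ S) (χ S) ∎
    where
    open ≡-Reasoning
    f : Fin n → Fin n → ℕ
    f i j = χ S i * (χ S j * A i j)
    edge-𝟙 : ∀ i j → 𝟙 (⌊ i <? j ⌋ ∧ ((S i ∧ S j) ∧ adj G i j)) ≡ 𝟙 ⌊ i <? j ⌋ * f i j
    edge-𝟙 i j = begin
      𝟙 (⌊ i <? j ⌋ ∧ ((S i ∧ S j) ∧ adj G i j))   ≡⟨ 𝟙-∧ ⌊ i <? j ⌋ _ ⟩
      𝟙 ⌊ i <? j ⌋ * 𝟙 ((S i ∧ S j) ∧ adj G i j)    ≡⟨ cong (𝟙 ⌊ i <? j ⌋ *_) (𝟙-∧ (S i ∧ S j) _) ⟩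
      𝟙 ⌊ i <? j ⌋ * (𝟙 (S i ∧ S j) * A i j)         ≡⟨ cong (λ m → 𝟙 ⌊ i <? j ⌋ * (m * A i j)) (𝟙-∧ (S i) (S j)) ⟩
      𝟙 ⌊ i <? j ⌋ * (χ S i * χ S j * A i j)         ≡⟨ cong (𝟙 ⌊ i <? j ⌋ *_) (*-assoc (χ S i) (χ S j) (A i j)) ⟩
      𝟙 ⌊ i <? j ⌋ * f i j                           ∎
    f-sym : ∀ i j → f i j ≡ f j i
    f-sym i j rewrite adj-sym G i j = x∙yz≈y∙xz (χ S i) (χ S j) (A j i)
    f-diag : ∀ i → f i i ≡ 0
    f-diag i rewrite irrefl G i = trans (cong (χ S i *_) (*-zeroʳ (χ S i))) (*-zeroʳ (χ S i))

removal-loss : ∀ s w w′ c → w ≡ w′ + c → s * c ≤ 2 * w → w * (s ∸ 2) ≤ w′ * s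
removal-loss 0             w w′ c _ _ rewrite *-zeroʳ w = z≤n
removal-loss 1             w w′ c _ _ rewrite *-zeroʳ w = z≤n
removal-loss s@(suc (suc r)) w w′ c refl sc≤2w = +-cancelˡ-≤ (2 * w) _ _ (begin
  2 * w + w * r         ≡⟨ split w′ c r ⟩
  w′ * s + s * c        ≤⟨ +-monoʳ-≤ (w′ * s) sc≤2w ⟩
  w′ * s + 2 * w        ≡⟨ +-comm (w′ * s) (2 * w) ⟩
  2 * w + w′ * s        ∎)
  where
  open ≤-Reasoning
  split : ∀ w′ c r → 2 * (w′ + c) + (w′ + c) * r ≡ w′ * (2 + r) + (2 + r) * c
  split = solve-∀

binomial-step : ∀ k r w w′ w″ → k ≤ r → w * (r ∸ 1) ≤ w′ * suc r →
  w′ * (k * (k ∸ 1)) ≤ w″ * (r * (r ∸ 1)) → w * (k * (k ∸ 1)) ≤ w″ * (suc r * r)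
binomial-step 0 r w w′ w″ _ _ _ rewrite *-zeroʳ w = z≤n
binomial-step 1 r w w′ w″ _ _ _ rewrite *-zeroʳ w = z≤n
binomial-step (suc (suc _)) 1 _ _ _ (s≤s ()) _ _
binomial-step k@(suc (suc _)) r@(suc (suc r″)) w w′ w″ _ loss decay = *-cancelˡ-≤ (suc r″) (begin
  suc r″ * (w * K)           ≡⟨ reassoc (suc r″) w K ⟩
  (w * suc r″) * K           ≤⟨ *-monoˡ-≤ K loss ⟩
  (w′ * suc r) * K           ≡⟨ reassoc (suc r) w′ K ⟨
  suc r * (w′ * K)           ≤⟨ *-monoʳ-≤ (suc r) decay ⟩
  suc r * (w″ * (r * suc r″)) ≡⟨ rearrange (suc r) w″ r (suc r″) ⟩
  suc r″ * (w″ * (suc r * r)) ∎)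
  where
  open ≤-Reasoning
  K = k * (k ∸ 1)
  reassoc : ∀ a b c → a * (b * c) ≡ (b * a) * c
  reassoc = solve-∀
  rearrange : ∀ a b c d → a * (b * (c * d)) ≡ d * (b * (a * c))
  rearrange = solve-∀

module _ {n : ℕ} (W : (Fin n → Bool) → ℕ) (c : (Fin n → Bool) → Fin n → ℕ)
  (W-─ : ∀ Z {v} → Z v ≡ true → W Z ≡ W (Z ─ v) + c Z v)
  (∑c≤2W : ∀ Z → ∑[ u < n ] (χ Z u * c Z u) ≤ 2 * W Z) where

  greedy-deletion : ∀ k m Z → count Z ≡ m + k →
    Σ (Fin n → Bool) λ Z′ → (∀ u → Z′ u ≡ true → Z u ≡ true) × count Z′ ≡ k
      × W Z * (k * (k ∸ 1)) ≤ W Z′ * ((m + k) * (m + k ∸ 1))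
  greedy-deletion k zero Z ∣Z∣≡k = Z , (λ _ Zu → Zu) , ∣Z∣≡k , ≤-refl
  greedy-deletion k (suc m) Z ∣Z∣≡1+m+k
    with v , Zv , cheap ← average-witness Z (c Z) (subst (0 <_) (sym ∣Z∣≡1+m+k) z<s)
    with Z′ , Z′⊆Z─v , ∣Z′∣≡k , decay ← greedy-deletion k m (Z ─ v) (suc-injective (trans (sym (count-─ Z Zv)) ∣Z∣≡1+m+k))
    = Z′ , (λ u Z′u → proj₁ (∧-true⁻ (Z′⊆Z─v u Z′u))) , ∣Z′∣≡k ,
      binomial-step k (m + k) (W Z) (W (Z ─ v)) (W Z′) (m≤n+m k m) loss decay
    where
    loss : W Z * (m + k ∸ 1) ≤ W (Z ─ v) * suc (m + k)
    loss = subst (λ s → W Z * (s ∸ 2) ≤ W (Z ─ v) * s) ∣Z∣≡1+m+k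
      (removal-loss (count Z) (W Z) (W (Z ─ v)) (c Z v) (W-─ Z Zv) (≤-trans cheap (∑c≤2W Z)))

module _ {n : ℕ} (G : Graph n) (x : Fin n → ℕ) where

  gain : (Fin n → Bool) → ℕ
  gain Z = 2 * pairs G (χ Z) x + pairs G (χ Z) (χ Z)

  marginal : (Fin n → Bool) → Fin n → ℕ
  marginal Z v = 2 * deg G x v + 2 * deg G (χ Z) v

  gain-─ : ∀ Z {v} → Z v ≡ true → gain Z ≡ gain (Z ─ v) + marginal Z v
  gain-─ Z {v} Zv = begin
    2 * pairs G z x + pairs G z z
      ≡⟨ cong₂ (λ a b → 2 * a + b) zx zz ⟩
    2 * (pairs G z′ x + deg G x v) + (pairs G z′ z′ + deg G z v + deg G z v)
      ≡⟨ regroup (pairs G z′ x) (pairs G z′ z′) (deg G x v) (deg G z v) ⟩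
    gain (Z ─ v) + marginal Z v ∎
    where
    open ≡-Reasoning
    z  = χ Z
    z′ = χ (Z ─ v)
    split : ∀ u → z u ≡ z′ u + δ v u
    split = χ-─ Z Zv
    deg-z≡deg-z′ : deg G z v ≡ deg G z′ v
    deg-z≡deg-z′ = begin
      deg G z v                  ≡⟨ deg-+ G z′ (δ v) split v ⟩
      deg G z′ v + deg G (δ v) v ≡⟨ cong (_+_ (deg G z′ v)) (trans (deg-δ G v v) (cong 𝟙 (irrefl G v))) ⟩
      deg G z′ v + 0             ≡⟨ +-identityʳ _ ⟩
      deg G z′ v                 ∎
    zx : pairs G z x ≡ pairs G z′ x + deg G x v
    zx = trans (pairs-+ˡ G z′ (δ v) x split) (cong (_+_ (pairs G z′ x)) (pairs-δˡ G v x))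
    zz : pairs G z z ≡ pairs G z′ z′ + deg G z v + deg G z v
    zz = begin
      pairs G z z                                   ≡⟨ pairs-+ˡ G z′ (δ v) z split ⟩
      pairs G z′ z + pairs G (δ v) z                ≡⟨ cong₂ _+_ (pairs-+ʳ G z′ z′ (δ v) split) (pairs-δˡ G v z) ⟩
      pairs G z′ z′ + pairs G z′ (δ v) + deg G z v  ≡⟨ cong (λ a → pairs G z′ z′ + a + deg G z v) (pairs-comm G z′ (δ v)) ⟩
      pairs G z′ z′ + pairs G (δ v) z′ + deg G z v  ≡⟨ cong (λ a → pairs G z′ z′ + a + deg G z v) (trans (pairs-δˡ G v z′) (sym deg-z≡deg-z′)) ⟩
      pairs G z′ z′ + deg G z v + deg G z v         ∎
    regroup : ∀ p q a b → 2 * (p + a) + (q + b + b) ≡ (2 * p + q) + (2 * a + 2 * b)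
    regroup = solve-∀

  ∑marginal≤2gain : ∀ Z → ∑[ u < n ] (χ Z u * marginal Z u) ≤ 2 * gain Z
  ∑marginal≤2gain Z = begin
    ∑[ u < n ] (χ Z u * marginal Z u)
      ≡⟨ sum-cong-≗ {n} (λ u → distrib (χ Z u) (deg G x u) (deg G (χ Z) u)) ⟩
    ∑[ u < n ] (2 * (χ Z u * deg G x u) + 2 * (χ Z u * deg G (χ Z) u))
      ≡⟨ ∑-distrib-+ {n} _ _ ⟩
    ∑[ u < n ] (2 * (χ Z u * deg G x u)) + ∑[ u < n ] (2 * (χ Z u * deg G (χ Z) u))
      ≡⟨ sym (cong₂ _+_ (*-distribˡ-sum {n} 2 _) (*-distribˡ-sum {n} 2 _)) ⟩
    2 * pairs G (χ Z) x + 2 * pairs G (χ Z) (χ Z)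
      ≤⟨ +-monoˡ-≤ (2 * pairs G (χ Z) (χ Z)) (m≤m+n (2 * pairs G (χ Z) x) (2 * pairs G (χ Z) x)) ⟩
    2 * pairs G (χ Z) x + 2 * pairs G (χ Z) x + 2 * pairs G (χ Z) (χ Z)
      ≡⟨ regroup (pairs G (χ Z) x) (pairs G (χ Z) (χ Z)) ⟩
    2 * gain Z ∎
    where
    open ≤-Reasoning
    distrib : ∀ s a b → s * (2 * a + 2 * b) ≡ 2 * (s * a) + 2 * (s * b)
    distrib = solve-∀
    regroup : ∀ p q → 2 * p + 2 * p + 2 * q ≡ 2 * (2 * p + q)
    regroup = solve-∀

  gain-min-degree : ∀ t Z q → (∀ u → q u ≤ x u + χ Z u) → (∀ v → Z v ≡ true → t ≤ 2 * deg G q v) →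
    t * count Z ≤ 2 * gain Z
  gain-min-degree t Z q q≤ t≤ = ≤-trans (min-degree-pairs G t Z q t≤) (*-monoʳ-≤ 2 (begin
    pairs G z q                         ≤⟨ pairs-monoʳ-≤ G z q≤ ⟩
    pairs G z (λ u → x u + z u)         ≡⟨ pairs-+ʳ G z x z (λ _ → refl) ⟩
    pairs G z x + pairs G z z           ≤⟨ +-monoˡ-≤ (pairs G z z) (m≤m+n (pairs G z x) _) ⟩
    gain Z                              ∎))
    where
    open ≤-Reasoning
    z = χ Z

  edgeCount-∪ : ∀ S T → (∀ u → χ S u ≡ x u + χ T u) → 2 * edgeCount (induced G S) ≡ pairs G x x + gain T
  edgeCount-∪ S T S≡ = begin
    2 * edgeCount (induced G S)               ≡⟨ edgeCount-induced G S ⟩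
    pairs G s s                               ≡⟨ pairs-+ˡ G x t s S≡ ⟩
    pairs G x s + pairs G t s                 ≡⟨ cong₂ _+_ (pairs-+ʳ G x x t S≡) (pairs-+ʳ G t x t S≡) ⟩
    (pairs G x x + pairs G x t) + (pairs G t x + pairs G t t)
                                              ≡⟨ cong (λ a → (pairs G x x + a) + (pairs G t x + pairs G t t)) (pairs-comm G x t) ⟩
    (pairs G x x + pairs G t x) + (pairs G t x + pairs G t t)
                                              ≡⟨ regroup (pairs G x x) (pairs G t x) (pairs G t t) ⟩
    pairs G x x + gain T                      ∎
    where
    open ≡-Reasoning
    s = χ S
    t = χ T
    regroup : ∀ a b c → (a + b) + (b + c) ≡ a + (2 * b + c)
    regroup = solve-∀

greedy-bound : ∀ t b′ k g g′ → k ≤ b′ → t * b′ ≤ 2 * g → g * (k * (k ∸ 1)) ≤ g′ * (b′ * (b′ ∸ 1)) →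
  t * (k * (k ∸ 1)) ≤ 2 * g′ * (b′ ∸ 1)
greedy-bound t zero    zero g g′ _ _ _ rewrite *-zeroʳ t = z≤n
greedy-bound t (suc b) k    g g′ _ tb′≤2g decay = *-cancelˡ-≤ (suc b) (begin
  suc b * (t * K)            ≡⟨ reassoc (suc b) t K ⟩
  (t * suc b) * K            ≤⟨ *-monoˡ-≤ K tb′≤2g ⟩
  (2 * g) * K                ≡⟨ *-assoc 2 g K ⟩
  2 * (g * K)                ≤⟨ *-monoʳ-≤ 2 decay ⟩
  2 * (g′ * (suc b * b))     ≡⟨ rearrange g′ b ⟩
  suc b * (2 * g′ * b)       ∎)
  where
  open ≤-Reasoning
  K = k * (k ∸ 1)
  reassoc : ∀ a b c → a * (b * c) ≡ (b * a) * c
  reassoc = solve-∀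
  rearrange : ∀ g b → 2 * (g * (suc b * b)) ≡ suc b * (2 * g * b)
  rearrange = solve-∀

dense-extension : ∀ {n} (G : Graph n) (X Y : Subset n) t → ∣ X ∣ ≤ t → t ≤ ∣ X ∪ Y ∣ →
  (∀ v → v ∈ Y → t ≤ 2 * degIn G Y v) →
  Σ (Fin n → Bool) λ S → count S ≡ t × Σ ℕ λ g →
    2 * edgeCount (induced G S) ≡ pairs G (χ (lookup X)) (χ (lookup X)) + g
      × t * ((t ∸ ∣ X ∣) * (t ∸ ∣ X ∣ ∸ 1)) ≤ 2 * g * ∣ Y ∣
dense-extension {n} G X Y t ∣X∣≤t t≤∣X∪Y∣ δ[Y] =
  S , ∣S∣≡t , gain G x T , edgeCount-∪ G x S T χS≡ , ≤-trans tK≤ (*-monoʳ-≤ (2 * gain G x T) (≤-trans (m∸n≤m b′ 1) (count∖≤∣∣ X Y)))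
  where
  x = χ (lookup X)
  Y∖X = lookup Y ∖ lookup X
  b′ = count Y∖X
  k = t ∸ ∣ X ∣
  a+k≡t : ∣ X ∣ + k ≡ t
  a+k≡t = m+[n∸m]≡n ∣X∣≤t
  k≤b′ : k ≤ b′
  k≤b′ = t∸∣X∣≤count∖ X Y t≤∣X∪Y∣
  tb′≤ : t * b′ ≤ 2 * gain G x Y∖X
  tb′≤ = gain-min-degree G x t Y∖X (χ (lookup Y)) (λ u → 𝟙-≤-𝟙+𝟙-∧-not (lookup X u) (lookup Y u))
    (λ v Y∖Xv → min-degree-lookup G Y δ[Y] v (proj₁ (∧-true⁻ Y∖Xv)))
  greedy = greedy-deletion (gain G x) (marginal G x) (gain-─ G x) (∑marginal≤2gain G x) k (b′ ∸ k) Y∖X (sym (m∸n+n≡m k≤b′))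
  T : Fin n → Bool
  T = proj₁ greedy
  T⊆Y∖X : ∀ u → T u ≡ true → Y∖X u ≡ true
  T⊆Y∖X = proj₁ (proj₂ greedy)
  ∣T∣≡k : count T ≡ k
  ∣T∣≡k = proj₁ (proj₂ (proj₂ greedy))
  decay : gain G x Y∖X * (k * (k ∸ 1)) ≤ gain G x T * (b′ * (b′ ∸ 1))
  decay = subst (λ s → gain G x Y∖X * (k * (k ∸ 1)) ≤ gain G x T * (s * (s ∸ 1))) (m∸n+n≡m k≤b′) (proj₂ (proj₂ (proj₂ greedy)))
  S : Fin n → Bool
  S u = lookup X u ∨ T u
  χS≡ : ∀ u → χ S u ≡ x u + χ T u
  χS≡ u = 𝟙-∨-disjoint (lookup X u) (T u) (λ Tu → Bool.not-injective (proj₂ (∧-true⁻ (T⊆Y∖X u Tu))))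
  ∣S∣≡t : count S ≡ t
  ∣S∣≡t = trans (sum-cong-≗ {n} χS≡) (trans (∑-distrib-+ {n} x (χ T)) (trans (cong₂ _+_ (sym (∣∣≡count X)) ∣T∣≡k) a+k≡t))
  tK≤ : t * (k * (k ∸ 1)) ≤ 2 * gain G x T * (b′ ∸ 1)
  tK≤ = greedy-bound t b′ k (gain G x Y∖X) (gain G x T) k≤b′ tb′≤ decay

k*k≡k*[k∸1]+k : ∀ k → k * k ≡ k * (k ∸ 1) + k
k*k≡k*[k∸1]+k zero    = refl
k*k≡k*[k∸1]+k (suc k) = expand k
  where
  expand : ∀ k → suc k * suc k ≡ suc k * k + suc k
  expand = solve-∀

counting-bound : ∀ t₁ a b k e P g → 2 * e ≡ P + g → suc t₁ * a ≤ 2 * P →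
  suc t₁ * (k * (k ∸ 1)) ≤ 2 * g * b → k ≤ b → t₁ * (a * b + k * k) ≤ 4 * b * e + 2 * b * t₁
counting-bound t₁ a b k e P g 2e≡P+g ta≤2P tK≤2gb k≤b = begin
  t₁ * (a * b + k * k)                       ≡⟨ cong (λ s → t₁ * (a * b + s)) (k*k≡k*[k∸1]+k k) ⟩
  t₁ * (a * b + (K + k))                     ≡⟨ expand t₁ a b K k ⟩
  t₁ * a * b + t₁ * K + t₁ * k               ≤⟨ +-mono-≤ (+-mono-≤ ab-part K-part) (*-monoʳ-≤ t₁ k≤b) ⟩
  2 * P * b + 2 * g * b + t₁ * b             ≡⟨ collect P g b t₁ ⟩
  b * (2 * (P + g)) + t₁ * b                 ≡⟨ cong (λ s → b * (2 * s) + t₁ * b) (sym 2e≡P+g) ⟩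
  b * (2 * (2 * e)) + t₁ * b                 ≤⟨ +-monoʳ-≤ (b * (2 * (2 * e))) (m≤m+n (t₁ * b) (t₁ * b)) ⟩
  b * (2 * (2 * e)) + (t₁ * b + t₁ * b)      ≡⟨ tidy b e t₁ ⟩
  4 * b * e + 2 * b * t₁                     ∎
  where
  open ≤-Reasoning
  K = k * (k ∸ 1)
  ab-part : t₁ * a * b ≤ 2 * P * b
  ab-part = *-monoˡ-≤ b (≤-trans (*-monoˡ-≤ a (n≤1+n t₁)) ta≤2P)
  K-part : t₁ * K ≤ 2 * g * b
  K-part = ≤-trans (*-monoˡ-≤ K (n≤1+n t₁)) tK≤2gb
  expand : ∀ t a b K k → t * (a * b + (K + k)) ≡ t * a * b + t * K + t * k
  expand = solve-∀
  collect : ∀ P g b t → 2 * P * b + 2 * g * b + t * b ≡ b * (2 * (P + g)) + t * b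
  collect = solve-∀
  tidy : ∀ b e t → b * (2 * (2 * e)) + (t * b + t * b) ≡ 4 * b * e + 2 * b * t
  tidy = solve-∀

ι : ℕ → ℚ
ι n = + n / 1

toℚᵘ-/ : ∀ z d → toℚᵘ (z / suc d) ≃ᵘ mkℚᵘ z d
toℚᵘ-/ z d = ℚ.toℚᵘ-fromℚᵘ (mkℚᵘ z d)

ι-+ : ∀ m n → ι (m + n) ≡ ι m +ℚ ι n
ι-+ m n = ℚ.toℚᵘ-injective (begin
  toℚᵘ (ι (m + n))                  ≈⟨ toℚᵘ-/ (+ (m + n)) 0 ⟩
  mkℚᵘ (+ (m + n)) 0                ≈⟨ *≡* (cong (ℤ._* + 1) (trans (ℤ.pos-+ m n) (sym (cong₂ ℤ._+_ (ℤ.*-identityʳ (+ m)) (ℤ.*-identityʳ (+ n)))))) ⟩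
  mkℚᵘ (+ m) 0 ℚᵘ.+ mkℚᵘ (+ n) 0    ≈⟨ ℚᵘ.+-cong (toℚᵘ-/ (+ m) 0) (toℚᵘ-/ (+ n) 0) ⟨
  toℚᵘ (ι m) ℚᵘ.+ toℚᵘ (ι n)        ≈⟨ ℚ.toℚᵘ-homo-+ (ι m) (ι n) ⟨
  toℚᵘ (ι m +ℚ ι n)                 ∎)
  where open ℚᵘ.≃-Reasoning

ι-* : ∀ m n → ι (m * n) ≡ ι m *ℚ ι n
ι-* m n = ℚ.toℚᵘ-injective (begin
  toℚᵘ (ι (m * n))                  ≈⟨ toℚᵘ-/ (+ (m * n)) 0 ⟩
  mkℚᵘ (+ (m * n)) 0                ≈⟨ *≡* (cong (ℤ._* + 1) (ℤ.pos-* m n)) ⟩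
  mkℚᵘ (+ m) 0 ℚᵘ.* mkℚᵘ (+ n) 0    ≈⟨ ℚᵘ.*-cong (toℚᵘ-/ (+ m) 0) (toℚᵘ-/ (+ n) 0) ⟨
  toℚᵘ (ι m) ℚᵘ.* toℚᵘ (ι n)        ≈⟨ ℚ.toℚᵘ-homo-* (ι m) (ι n) ⟨
  toℚᵘ (ι m *ℚ ι n)                 ∎)
  where open ℚᵘ.≃-Reasoning

ι-mono-≤ : ∀ {m n} → m ≤ n → ι m ≤ℚ ι n
ι-mono-≤ {m} {n} m≤n = ℚ.toℚᵘ-cancel-≤
  (ℚᵘ.≤-respʳ-≃ (ℚᵘ.≃-sym (toℚᵘ-/ (+ n) 0)) (ℚᵘ.≤-respˡ-≃ (ℚᵘ.≃-sym (toℚᵘ-/ (+ m) 0))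
    (*≤* (ℤ.*-monoʳ-≤-nonNeg (+ 1) (ℤ.+≤+ m≤n)))))

/-as-ι : ∀ m d → + m / suc d ≡ ι m *ℚ (+ 1 / suc d)
/-as-ι m d = ℚ.toℚᵘ-injective (begin
  toℚᵘ (+ m / suc d)                      ≈⟨ toℚᵘ-/ (+ m) d ⟩
  mkℚᵘ (+ m) d                            ≈⟨ *≡* (cong₂ ℤ._*_ (sym (ℤ.*-identityʳ (+ m))) (cong (λ e → + suc e) (+-identityʳ d))) ⟩
  mkℚᵘ (+ m) 0 ℚᵘ.* mkℚᵘ (+ 1) d          ≈⟨ ℚᵘ.*-cong (toℚᵘ-/ (+ m) 0) (toℚᵘ-/ (+ 1) d) ⟨
  toℚᵘ (ι m) ℚᵘ.* toℚᵘ (+ 1 / suc d)      ≈⟨ ℚ.toℚᵘ-homo-* (ι m) (+ 1 / suc d) ⟨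
  toℚᵘ (ι m *ℚ (+ 1 / suc d))             ∎)
  where open ℚᵘ.≃-Reasoning

ι*1/≡1 : ∀ d → ι (suc d) *ℚ (+ 1 / suc d) ≡ 1ℚ
ι*1/≡1 d = trans (sym (/-as-ι (suc d) d)) (ℚ.toℚᵘ-injective (ℚᵘ.≃-trans (toℚᵘ-/ (+ suc d) d) (*≡* (ℤ.*-comm (+ suc d) (+ 1)))))

2*[nC2]≡n*[n∸1] : ∀ n → 2 * (n C 2) ≡ n * (n ∸ 1)
2*[nC2]≡n*[n∸1] zero          = refl
2*[nC2]≡n*[n∸1] (suc zero)    = refl
2*[nC2]≡n*[n∸1] (suc (suc m)) = begin
  2 * (suc (suc m) C 2)        ≡⟨ cong (2 *_) (sym (nCk+nC[k+1]≡[n+1]C[k+1] (suc m) 1)) ⟩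
  2 * (suc m C 1 + suc m C 2)  ≡⟨ cong (λ c → 2 * (c + suc m C 2)) (nC1≡n (suc m)) ⟩
  2 * (suc m + suc m C 2)      ≡⟨ *-distribˡ-+ 2 (suc m) _ ⟩
  2 * suc m + 2 * (suc m C 2)  ≡⟨ cong (λ c → 2 * suc m + c) (2*[nC2]≡n*[n∸1] (suc m)) ⟩
  2 * suc m + suc m * m        ≡⟨ pascal m ⟩
  suc (suc m) * suc m          ∎
  where
  open ≡-Reasoning
  pascal : ∀ m → 2 * suc m + suc m * m ≡ suc (suc m) * suc m
  pascal = solve-∀

p≤q+r⇒p-r≤q : ∀ {p q r} → p ≤ℚ q +ℚ r → p -ℚ r ≤ℚ q
p≤q+r⇒p-r≤q {p} {q} {r} p≤q+r = ℚ.≤-trans (ℚ.+-monoˡ-≤ (ℚ.-_ r) p≤q+r) (ℚ.≤-reflexive (solve 2 (λ q r → (q :+ r) :- r := q) refl q r))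
  where open +-*-Solver

-- Multiplied by M = 4bt > 0, the claim becomes t₁ (ab + k²) − 2bt₁ ≤ 4be.
scaled-bound : ∀ t₁ a b₁ k e (R : ℚ) → ι (suc b₁) *ℚ ι (suc t₁) *ℚ R ≡ ι k *ℚ ι k →
  t₁ * (a * suc b₁ + k * k) ≤ 4 * suc b₁ * e + 2 * suc b₁ * t₁ →
  (½ *ℚ (ι a *ℚ (+ 1 / suc t₁) +ℚ R) -ℚ + 1 / suc t₁) *ℚ ι (suc t₁ C 2) ≤ℚ ι e
scaled-bound t₁ a b₁ k e R BTR≡KK counted = ℚ.*-cancelˡ-≤-pos M (begin
  M *ℚ ((½ *ℚ (A *ℚ U +ℚ R) -ℚ U) *ℚ Cq)
    ≡⟨ cong (λ c → M *ℚ ((½ *ℚ (A *ℚ U +ℚ R) -ℚ U) *ℚ c)) Cq≡ ⟩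
  M *ℚ ((½ *ℚ (A *ℚ U +ℚ R) -ℚ U) *ℚ (½ *ℚ (T *ℚ T₁)))
    ≡⟨ solve 6 (λ A B T T₁ U R →
         con (ι 4) :* B :* T :* ((con ½ :* (A :* U :+ R) :- U) :* (con ½ :* (T :* T₁)))
         := T :* (T₁ :* (A :* B :* (T :* U) :+ B :* T :* R :- con (ι 2) :* B :* (T :* U))))
         refl A B T T₁ U R ⟩
  T *ℚ (T₁ *ℚ (A *ℚ B *ℚ (T *ℚ U) +ℚ B *ℚ T *ℚ R -ℚ ι 2 *ℚ B *ℚ (T *ℚ U)))
    ≡⟨ cong₂ (λ tu btr → T *ℚ (T₁ *ℚ (A *ℚ B *ℚ tu +ℚ btr -ℚ ι 2 *ℚ B *ℚ tu))) (ι*1/≡1 t₁) BTR≡KK ⟩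
  T *ℚ (T₁ *ℚ (A *ℚ B *ℚ 1ℚ +ℚ K *ℚ K -ℚ ι 2 *ℚ B *ℚ 1ℚ))
    ≡⟨ cong (T *ℚ_) (solve 4 (λ T₁ A B K → T₁ :* (A :* B :* con 1ℚ :+ K :* K :- con (ι 2) :* B :* con 1ℚ)
                                     := T₁ :* (A :* B :+ K :* K) :- con (ι 2) :* B :* T₁) refl T₁ A B K) ⟩
  T *ℚ (T₁ *ℚ (A *ℚ B +ℚ K *ℚ K) -ℚ ι 2 *ℚ B *ℚ T₁)
    ≤⟨ ℚ.*-monoˡ-≤-nonNeg T (p≤q+r⇒p-r≤q (subst₂ _≤ℚ_ lhs≡ rhs≡ (ι-mono-≤ counted))) ⟩
  T *ℚ (ι 4 *ℚ B *ℚ E)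
    ≡⟨ solve 3 (λ B T E → T :* (con (ι 4) :* B :* E) := con (ι 4) :* B :* T :* E) refl B T E ⟩
  M *ℚ E ∎)
  where
  open ℚ.≤-Reasoning
  open +-*-Solver
  T = ι (suc t₁)
  T₁ = ι t₁
  U = + 1 / suc t₁
  A = ι a
  B = ι (suc b₁)
  K = ι k
  E = ι e
  Cq = ι (suc t₁ C 2)
  M = ι 4 *ℚ B *ℚ T
  instance
    M-pos : Positive M
    M-pos = subst Positive (trans (ι-* (4 * suc b₁) (suc t₁)) (cong (_*ℚ T) (ι-* 4 (suc b₁)))) (ℚ.normalize-pos (4 * suc b₁ * suc t₁) 1)
    T-nonNeg : NonNegative T
    T-nonNeg = ℚ.normalize-nonNeg (suc t₁) 1
  Cq≡ : Cq ≡ ½ *ℚ (T *ℚ T₁)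
  Cq≡ = begin-equality
    Cq                   ≡⟨ solve 1 (λ c → c := con ½ :* (con (ι 2) :* c)) refl Cq ⟩
    ½ *ℚ (ι 2 *ℚ Cq)     ≡⟨ cong (½ *ℚ_) (trans (sym (ι-* 2 (suc t₁ C 2))) (trans (cong ι (2*[nC2]≡n*[n∸1] (suc t₁))) (ι-* (suc t₁) t₁))) ⟩
    ½ *ℚ (T *ℚ T₁)       ∎
  lhs≡ : ι (t₁ * (a * suc b₁ + k * k)) ≡ T₁ *ℚ (A *ℚ B +ℚ K *ℚ K)
  lhs≡ = trans (ι-* t₁ _) (cong (T₁ *ℚ_) (trans (ι-+ (a * suc b₁) (k * k)) (cong₂ _+ℚ_ (ι-* a (suc b₁)) (ι-* k k))))
  rhs≡ : ι (4 * suc b₁ * e + 2 * suc b₁ * t₁) ≡ ι 4 *ℚ B *ℚ E +ℚ ι 2 *ℚ B *ℚ T₁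
  rhs≡ = trans (ι-+ (4 * suc b₁ * e) _) (cong₂ _+ℚ_
    (trans (ι-* (4 * suc b₁) e) (cong (_*ℚ E) (ι-* 4 (suc b₁))))
    (trans (ι-* (2 * suc b₁) t₁) (cong (_*ℚ T₁) (ι-* 2 (suc b₁)))))

rescale-square : ∀ A B K T U R → T *ℚ U ≡ 1ℚ → T ≡ A +ℚ K →
  R *ℚ (B *ℚ U) ≡ (1ℚ -ℚ A *ℚ U) *ℚ (1ℚ -ℚ A *ℚ U) → B *ℚ T *ℚ R ≡ K *ℚ K
rescale-square A B K T U R TU≡1 T≡A+K RBU≡ = begin
  B *ℚ T *ℚ R                                     ≡⟨ solve 4 (λ B T R U → B :* T :* R := B :* T :* R :* con 1ℚ) refl B T R U ⟩
  B *ℚ T *ℚ R *ℚ 1ℚ                               ≡⟨ cong (B *ℚ T *ℚ R *ℚ_) (sym TU≡1) ⟩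
  B *ℚ T *ℚ R *ℚ (T *ℚ U)                         ≡⟨ solve 4 (λ B T R U → B :* T :* R :* (T :* U) := T :* T :* (R :* (B :* U))) refl B T R U ⟩
  T *ℚ T *ℚ (R *ℚ (B *ℚ U))                       ≡⟨ cong (T *ℚ T *ℚ_) RBU≡ ⟩
  T *ℚ T *ℚ ((1ℚ -ℚ A *ℚ U) *ℚ (1ℚ -ℚ A *ℚ U))    ≡⟨ solve 3 (λ T A U → T :* T :* ((con 1ℚ :- A :* U) :* (con 1ℚ :- A :* U))
                                                          := (T :- A :* (T :* U)) :* (T :- A :* (T :* U))) refl T A U ⟩
  (T -ℚ A *ℚ (T *ℚ U)) *ℚ (T -ℚ A *ℚ (T *ℚ U))    ≡⟨ cong₂ (λ t tu → (t -ℚ A *ℚ tu) *ℚ (t -ℚ A *ℚ tu)) T≡A+K TU≡1 ⟩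
  (A +ℚ K -ℚ A *ℚ 1ℚ) *ℚ (A +ℚ K -ℚ A *ℚ 1ℚ)      ≡⟨ solve 2 (λ A K → (A :+ K :- A :* con 1ℚ) :* (A :+ K :- A :* con 1ℚ) := K :* K) refl A K ⟩
  K *ℚ K                                          ∎
  where
  open ≡-Reasoning
  open +-*-Solver

÷₀-elim : ∀ (P : ℚ → Set) p q → (q ≡ 0ℚ → P 0ℚ) → ((q≢0 : q ≢ 0ℚ) → P (_÷_ p q {{≢-nonZero q≢0}})) → P (p ÷₀ q)
÷₀-elim P p q zero-case nonzero-case with q ℚ.≟ 0ℚ
... | yes q≡0 = zero-case q≡0
... | no  q≢0 = nonzero-case q≢0

-- For b = 0 the convention p ÷₀ 0 = 0 applies and only t a ≤ 4 e is needed; it enters as the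
-- b = 1, k = 0 instance of the counting inequality.
density-bound : ∀ t₁ a b k e → a + k ≡ suc t₁ →
  t₁ * (a * 1 + 0 * 0) ≤ 4 * 1 * e + 2 * 1 * t₁ →
  t₁ * (a * b + k * k) ≤ 4 * b * e + 2 * b * t₁ →
  let x = + a / suc t₁
      y = + b / suc t₁
  in ((½ *ℚ (x +ℚ (((1ℚ -ℚ x) *ℚ (1ℚ -ℚ x)) ÷₀ y))) -ℚ (+ 1 / suc t₁)) *ℚ (+ (suc t₁ C 2) / 1) ≤ℚ (+ e / 1)
density-bound t₁ a b k e a+k≡t counted₁ counted =
  subst₂ Goal (sym (/-as-ι a t₁)) (sym (/-as-ι b t₁))
    (÷₀-elim (λ R → (½ *ℚ (A *ℚ U +ℚ R) -ℚ U) *ℚ Cq ≤ℚ ι e) ((1ℚ -ℚ A *ℚ U) *ℚ (1ℚ -ℚ A *ℚ U)) (ι b *ℚ U)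
      (empty-case b) (nonempty-case b counted))
  where
  U = + 1 / suc t₁
  T = ι (suc t₁)
  A = ι a
  Cq = ι (suc t₁ C 2)
  Goal : ℚ → ℚ → Set
  Goal x y = ((½ *ℚ (x +ℚ (((1ℚ -ℚ x) *ℚ (1ℚ -ℚ x)) ÷₀ y))) -ℚ U) *ℚ Cq ≤ℚ ι e
  empty-case : ∀ b → ι b *ℚ U ≡ 0ℚ → (½ *ℚ (A *ℚ U +ℚ 0ℚ) -ℚ U) *ℚ Cq ≤ℚ ι e
  empty-case zero _ = scaled-bound t₁ a 0 0 e 0ℚ (ℚ.*-zeroʳ (ι 1 *ℚ T)) counted₁
  empty-case (suc b₁) BU≡0 = contradiction (ℚ.positive⁻¹ (ι (suc b₁) *ℚ U) {{BU-pos}}) (ℚ.<-irrefl (sym BU≡0))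
    where
    BU-pos : Positive (ι (suc b₁) *ℚ U)
    BU-pos = subst Positive (/-as-ι (suc b₁) t₁) (ℚ.normalize-pos (suc b₁) (suc t₁))
  nonempty-case : ∀ b → t₁ * (a * b + k * k) ≤ 4 * b * e + 2 * b * t₁ → (BU≢0 : ι b *ℚ U ≢ 0ℚ) → let instance _ = ≢-nonZero BU≢0 in
    (½ *ℚ (A *ℚ U +ℚ (1ℚ -ℚ A *ℚ U) *ℚ (1ℚ -ℚ A *ℚ U) ÷ (ι b *ℚ U)) -ℚ U) *ℚ Cq ≤ℚ ι e
  nonempty-case zero _ BU≢0 = contradiction (ℚ.*-zeroˡ U) BU≢0
  nonempty-case (suc b₁) counted′ BU≢0 = scaled-bound t₁ a b₁ k e R
      (rescale-square A (ι (suc b₁)) (ι k) T U R (ι*1/≡1 t₁) (trans (cong ι (sym a+k≡t)) (ι-+ a k)) R*BU≡) counted′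
    where
    instance _ = ≢-nonZero BU≢0
    P = (1ℚ -ℚ A *ℚ U) *ℚ (1ℚ -ℚ A *ℚ U)
    BU = ι (suc b₁) *ℚ U
    R = P ÷ BU
    R*BU≡ : R *ℚ BU ≡ P
    R*BU≡ = trans (ℚ.*-assoc P (1/ BU) BU) (trans (cong (P *ℚ_) (ℚ.*-inverseˡ BU)) (ℚ.*-identityʳ P))

lemma2p4 : (t : ℕ) → .{{_ : NonZero t}} → (n : ℕ) → (G : Graph n) → (X Y : Subset n)
  → ∣ X ∣ ≤ t → t ≤ ∣ X ∪ Y ∣
  → (∀ v → v ∈ X → t ≤ 2 * degIn G X v)
  → (∀ v → v ∈ Y → t ≤ 2 * degIn G Y v)
  → let x = + ∣ X ∣ / t
        y = + ∣ Y ∣ / t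
    in Σ (Subgraph G) λ H → (vcount H ≡ t)
         × (((½ *ℚ (x +ℚ (((1ℚ -ℚ x) *ℚ (1ℚ -ℚ x)) ÷₀ y))) -ℚ (+ 1 / t)) *ℚ (+ (t C 2) / 1)
             ≤ℚ (+ edgeCount H / 1))
lemma2p4 zero n G X Y _ _ _ _ = contradiction refl (≢-nonZero⁻¹ 0)
lemma2p4 t@(suc t₁) n G X Y ∣X∣≤t t≤∣X∪Y∣ δ[X] δ[Y] =
  let S , ∣S∣≡t , g , 2e≡ , tK≤ = dense-extension G X Y t ∣X∣≤t t≤∣X∪Y∣ δ[Y]
      e = edgeCount (induced G S)
  in induced G S , trans (vcount-induced G S) ∣S∣≡t ,
     density-bound t₁ a b k e (m+[n∸m]≡n ∣X∣≤t)
       (counting-bound t₁ a 1 0 e P g 2e≡ ta≤2P (≤-trans (≤-reflexive (*-zeroʳ t)) z≤n) z≤n)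
       (counting-bound t₁ a b k e P g 2e≡ ta≤2P tK≤ (≤-trans (t∸∣X∣≤count∖ X Y t≤∣X∪Y∣) (count∖≤∣∣ X Y)))
  where
  a = ∣ X ∣
  b = ∣ Y ∣
  k = t ∸ a
  P = pairs G (χ (lookup X)) (χ (lookup X))
  ta≤2P : t * a ≤ 2 * P
  ta≤2P = subst (λ c → t * c ≤ 2 * P) (sym (∣∣≡count X))
    (min-degree-pairs G t (lookup X) (χ (lookup X)) (min-degree-lookup G X δ[X]))
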